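{- Let $\mathcal{H}$ be the Heawood graph. In any $2$-coloring of $\mathcal{H}$, there are at least two bad vertices.
   Context: The Heawood graph $\mathcal{H}$ is the cubic bipartite graph on $14$ vertices that is the point–line incidence graph of the Fano plane (equivalently, the graph with vertices $0,1,\ldots,13$ forming a Hamiltonian cycle $0,1,\ldots,13,0$ together with chords $\{2i,2i+5 \bmod 14\}$ for $i=0,\ldots,6$). A $2$-coloring of a graph assigns to each vertex a color from $\{0,1\}$. In a given $2$-coloring, a vertex is good if its open neighborhood contains vertices of both colors $0$ and $1$, and bad otherwise. -}

module Defs where

open import Data.Nat using (ℕ; _+_; _*_; _%_)
open import Data.Fin using (Fin; toℕ; zero; suc)
open import Data.Bool using (Bool; true; false)
open import Data.Product using (Σ; _×_; ∃-syntax)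
open import Data.Sum using (_⊎_)
open import Relation.Binary.PropositionalEquality using (_≡_)
open import Relation.Nullary using (¬_)

Vertex : Set
Vertex = Fin 14

data Edge : ℕ → ℕ → Set where
  cyc   : (i : ℕ) → Edge i ((i + 1) % 14)
  chord : (i : ℕ) → Edge (2 * i) ((2 * i + 5) % 14)

-- For i ranging over all ℕ the generated pairs are exactly those with i < 14
-- (resp. i < 7), since the first endpoint must be the label of a vertex.
Adj : Vertex → Vertex → Set
Adj u v = Edge (toℕ u) (toℕ v) ⊎ Edge (toℕ v) (toℕ u)

Coloring : Set
Coloring = Vertex → Fin 2

Good : Coloring → Vertex → Set
Good c v = (∃[ u ] (Adj v u × c u ≡ zero)) × (∃[ w ] (Adj v w × c w ≡ suc zero))

Bad : Coloring → Vertex → Set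
Bad c v = ¬ Good c v

-- The even vertices 2i and the odd vertices 2j + 1 are the points and the lines of a
-- Fano plane on ℤ₇, line j being {j, j + 1, j + 5}; a point is bad when the three lines
-- through it have one colour, and a line when its three points do. Neither the Fano
-- plane nor its dual is 2-colourable (checked over all 2⁷ colourings), so the colouring
-- of the points leaves a bad line and the colouring of the lines a bad point.
module Submission where

open import Defs
open import Data.Fin using (Fin)
open import Data.Product using (_×_; ∃-syntax)
open import Relation.Binary.PropositionalEquality using (_≢_)

open import Data.Nat using (ℕ; _+_; _*_; _%_)
open import Data.Nat.DivMod using (_mod_)
open import Data.Nat.Divisibility using (_∣_; _∣?_; m∣m*n)
open import Data.Fin using (toℕ; _≟_)
open import Data.Fin.Base using (finToFun; funToFin)
open import Data.Fin.Properties using (all?; any?; finToFun-funToFin; 0≢1+n)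
open import Data.Nat.Properties using () renaming (_≟_ to _≟ℕ_)
open import Data.Product using (_,_)
open import Data.Sum using (_⊎_; inj₁; inj₂)
import Data.Sum as Sum
open import Function using (_∘_)
open import Relation.Binary.PropositionalEquality using (_≡_; _≗_; refl; sym; trans)
open import Relation.Nullary using (Dec)
open import Relation.Nullary.Decidable using (_×-dec_; _⊎-dec_; _→-dec_; ¬?; from-yes)

_⊕_ : Fin 7 → ℕ → Fin 7
i ⊕ k = (toℕ i + k) mod 7

MonochromaticTranslate : (Fin 7 → Fin 2) → ℕ → ℕ → Set
MonochromaticTranslate f a b = ∃[ j ] (f j ≡ f (j ⊕ a) × f j ≡ f (j ⊕ b))

monochromaticTranslate? : ∀ f a b → Dec (MonochromaticTranslate f a b)
monochromaticTranslate? f a b = any? λ j → (f j ≟ f (j ⊕ a)) ×-dec (f j ≟ f (j ⊕ b))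

monochromaticTranslate-resp : ∀ {f g a b} → f ≗ g →
  MonochromaticTranslate f a b → MonochromaticTranslate g a b
monochromaticTranslate-resp f≗g (j , fj≡fa , fj≡fb) =
  j , trans (sym (f≗g j)) (trans fj≡fa (f≗g _)) , trans (sym (f≗g j)) (trans fj≡fb (f≗g _))

monochromaticTranslate-all : ∀ {a b} → (∀ k → MonochromaticTranslate (finToFun k) a b) →
  ∀ f → MonochromaticTranslate f a b
monochromaticTranslate-all holds f =
  monochromaticTranslate-resp (finToFun-funToFin f) (holds (funToFin f))

-- Opaque, as unfolding these exhaustive checks where they are used is prohibitively expensive.
opaque
  fano-monochromatic-line : ∀ f → MonochromaticTranslate f 1 5
  fano-monochromatic-line = monochromaticTranslate-all
    (from-yes (all? λ k → monochromaticTranslate? (finToFun k) 1 5))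

  -- The lines through the point i are i, i ⊕ 6 and i ⊕ 2.
  fano-monochromatic-pencil : ∀ f → MonochromaticTranslate f 6 2
  fano-monochromatic-pencil = monochromaticTranslate-all
    (from-yes (all? λ k → monochromaticTranslate? (finToFun k) 6 2))

point line : Fin 7 → Vertex
point i = (2 * toℕ i) mod 14
line j = (2 * toℕ j + 1) mod 14

point≢line : ∀ i j → point i ≢ line j
point≢line = from-yes (all? λ i → all? λ j → ¬? (point i ≟ line j))

-- Edge a b with the chord index eliminated, which makes it decidable.
Arc : ℕ → ℕ → Set
Arc a b = b ≡ (a + 1) % 14 ⊎ (2 ∣ a × b ≡ (a + 5) % 14)

edge⇒arc : ∀ {a b} → Edge a b → Arc a b
edge⇒arc (cyc i)   = inj₁ refl
edge⇒arc (chord i) = inj₂ (m∣m*n i , refl)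

arc? : ∀ a b → Dec (Arc a b)
arc? a b = (b ≟ℕ (a + 1) % 14) ⊎-dec ((2 ∣? a) ×-dec (b ≟ℕ (a + 5) % 14))

NeighboursAmong : Vertex → Vertex → Vertex → Vertex → Set
NeighboursAmong v x y z = ∀ u → Adj v u → u ≡ x ⊎ u ≡ y ⊎ u ≡ z

ArcsAmong : Vertex → Vertex → Vertex → Vertex → Set
ArcsAmong v x y z = ∀ u → Arc (toℕ v) (toℕ u) ⊎ Arc (toℕ u) (toℕ v) → u ≡ x ⊎ u ≡ y ⊎ u ≡ z

arcsAmong? : ∀ v x y z → Dec (ArcsAmong v x y z)
arcsAmong? v x y z = all? λ u →
  (arc? (toℕ v) (toℕ u) ⊎-dec arc? (toℕ u) (toℕ v)) →-dec (u ≟ x ⊎-dec u ≟ y ⊎-dec u ≟ z)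

arcsAmong⇒neighboursAmong : ∀ {v x y z} → ArcsAmong v x y z → NeighboursAmong v x y z
arcsAmong⇒neighboursAmong arcs u = arcs u ∘ Sum.map edge⇒arc edge⇒arc

point-neighbours : ∀ i → NeighboursAmong (point i) (line i) (line (i ⊕ 6)) (line (i ⊕ 2))
point-neighbours = arcsAmong⇒neighboursAmong ∘
  from-yes (all? λ i → arcsAmong? (point i) (line i) (line (i ⊕ 6)) (line (i ⊕ 2)))

line-neighbours : ∀ j → NeighboursAmong (line j) (point j) (point (j ⊕ 1)) (point (j ⊕ 5))
line-neighbours = arcsAmong⇒neighboursAmong ∘
  from-yes (all? λ j → arcsAmong? (line j) (point j) (point (j ⊕ 1)) (point (j ⊕ 5)))

bad-if-neighbours-agree : ∀ {c v x y z} → NeighboursAmong v x y z →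
  c x ≡ c y → c x ≡ c z → Bad c v
bad-if-neighbours-agree {c} {v} {x} neighbours cx≡cy cx≡cz
  ((u , v~u , cu≡0) , (w , v~w , cw≡1)) =
  0≢1+n (trans (sym cu≡0) (trans (colour u v~u) (trans (sym (colour w v~w)) cw≡1)))
  where
  colour : ∀ u → Adj v u → c u ≡ c x
  colour u v~u with neighbours u v~u
  ... | inj₁ refl        = refl
  ... | inj₂ (inj₁ refl) = sym cx≡cy
  ... | inj₂ (inj₂ refl) = sym cx≡cz

lemma1 : (c : Coloring) → ∃[ u ] ∃[ v ] (u ≢ v × Bad c u × Bad c v)
lemma1 c with fano-monochromatic-pencil (c ∘ line) | fano-monochromatic-line (c ∘ point)
... | i , pencil₁ , pencil₂ | j , line₁ , line₂ =
  point i , line j , point≢line i j ,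
  bad-if-neighbours-agree (point-neighbours i) pencil₁ pencil₂ ,
  bad-if-neighbours-agree (line-neighbours j) line₁ line₂
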